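{- Let $\mathcal{F} = \{F_1,\dots,F_t\}$ be a collection of pairwise vertex-disjoint cycles, each with at least three vertices, and let $V(\mathcal{F}) = \bigcup_{i} V(F_i)$. Let $q_1,\dots,q_t$ be integers with $1 \leq q_i \leq |V(F_i)|-1$ for each $i$. If $S,T \subseteq V(\mathcal{F})$ satisfy $|S|,|T| > \tfrac{2}{3}|V(\mathcal{F})|$, then there exist an index $i$ and a path $P$ contained in the cycle $F_i$ with exactly $q_i$ vertices such that both end vertices of $P$ are in $S$ and some vertex of $T$ lies in $V(F_i) - V(P)$.
   Context: A path in a cycle $F$ means a subpath of $F$ (a set of consecutive vertices of $F$ together with the edges of $F$ between them); a one-vertex path has both end vertices equal to that vertex. -}

module Defs where

open import Data.Nat using (ℕ; zero; suc; _+_; _<_)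
open import Data.Nat.DivMod using (_mod_)
open import Data.Fin using (Fin; toℕ)
open import Data.Fin.Subset using (Subset; ∣_∣)
open import Data.List using (map; allFin)
open import Data.Nat.ListAction using (sum)
open import Data.Product using (∃; _×_)
open import Relation.Binary.PropositionalEquality using (_≡_)

-- A family of t pairwise vertex-disjoint cycles F_0 … F_{t-1}, where F_i has
-- n i vertices, is modelled (up to isomorphism) as the disjoint union of the
-- cycles C_{n i}: the vertices of F_i are Fin (n i), and vertex j is adjacent
-- to vertex j+1 (mod n i).

Σ[<_]_ : (t : ℕ) → (Fin t → ℕ) → ℕ
Σ[< t ] f = sum (map f (allFin t))

totalVerts : (t : ℕ) → (Fin t → ℕ) → ℕ
totalVerts t n = Σ[< t ] n

VSubset : (t : ℕ) → (Fin t → ℕ) → Set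
VSubset t n = (i : Fin t) → Subset (n i)

card : {t : ℕ} {n : Fin t → ℕ} → VSubset t n → ℕ
card {t} S = Σ[< t ] (λ i → ∣ S i ∣)

step : {n : ℕ} → Fin n → ℕ → Fin n
step {suc n} s k = (toℕ s + k) mod suc n

-- The path in the cycle C_n with q vertices starting at s (walking forward):
-- its vertex set is { step s k | k < q }, and its end vertices are s and
-- step s (q - 1).  Every path with 1 ≤ q ≤ n-1 vertices in C_n arises this way.
onPath : {n : ℕ} → (s : Fin n) → (q : ℕ) → Fin n → Set
onPath s q v = ∃ λ k → k < q × step s k ≡ v

-- For a single cycle C_n and 1 ≤ q < n, count over all start vertices s the
-- three events s ∈ S, s + (q - 1) ∈ S and s + q ∈ T.  Each map s ↦ s + k
-- is a rotation of the cycle, so the total count is 2|S| + |T|.  If no s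
-- realises all three events, the count is at most 2n; and s + q is never on
-- the path s, …, s + (q - 1) because q < n.  Summing 2|S_i| + |T_i| ≤ 2n_i
-- over the cycles contradicts |S|, |T| > 2/3 |V(𝓕)|.
module Submission where

open import Data.Bool using (Bool; true; false; if_then_else_)
open import Data.Empty using (⊥-elim)
open import Data.Fin using (Fin; toℕ; zero; suc; inject₁; fromℕ)
open import Data.Fin.Properties using (toℕ-injective; toℕ<n; toℕ-fromℕ<; toℕ-inject₁; toℕ-fromℕ)
open import Data.Fin.Subset using (Subset; ∣_∣; _∈_)
open import Data.List using (tabulate)
open import Data.List.Properties using (map-tabulate)
open import Data.Nat using (ℕ; zero; suc; _+_; _*_; _∸_; _%_; _≤_; _<_; z≤n; s≤s; _<?_)
open import Data.Nat.DivMod using (%-distribˡ-+; m%n%n≡m%n; m<n⇒m%n≡m; m%n<n; n%n≡0; m≤n⇒[n∸m]%m≡n%m)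
open import Data.Nat.ListAction as List using ()
open import Data.Nat.Properties
open import Data.Nat.Tactic.RingSolver using (solve-∀)
open import Data.Product using (Σ; ∃; _×_; _,_; proj₂)
open import Data.Sum using (_⊎_; inj₁; inj₂)
open import Data.Vec using ([]; _∷_; lookup)
open import Data.Vec.Properties using (lookup⇒[]=)
open import Defs
open import Function using (_∘_)
open import Relation.Binary.PropositionalEquality
open import Relation.Nullary using (¬_; yes; no)

open import Algebra.Properties.Semiring.Sum +-*-semiring
  using (sum; sum-syntax; ∑-distrib-+; *-distribˡ-sum; sum-cong-≗; sum-init-last)
open ≡-Reasoning

∑-const : ∀ n c → ∑[ i < n ] c ≡ c * n
∑-const zero    c = sym (*-zeroʳ c)
∑-const (suc n) c = trans (cong (c +_) (∑-const n c)) (sym (*-suc c n))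

Σ[<]≡∑ : ∀ t (f : Fin t → ℕ) → Σ[< t ] f ≡ sum f
Σ[<]≡∑ t f = trans (cong List.sum (map-tabulate (λ i → i) f)) (sum-tabulate t f)
  where
  sum-tabulate : ∀ t (f : Fin t → ℕ) → List.sum (tabulate f) ≡ sum f
  sum-tabulate zero    f = refl
  sum-tabulate (suc t) f = cong (f zero +_) (sum-tabulate t (f ∘ suc))

Σ[<]-*ˡ : ∀ t c (f : Fin t → ℕ) → ∑[ i < t ] (c * f i) ≡ c * Σ[< t ] f
Σ[<]-*ˡ t c f = trans (sym (*-distribˡ-sum c f)) (cong (c *_) (sym (Σ[<]≡∑ t f)))

Σ[<]-2a+b : ∀ t (a b : Fin t → ℕ) → ∑[ i < t ] (2 * a i + b i) ≡ 2 * Σ[< t ] a + Σ[< t ] b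
Σ[<]-2a+b t a b = trans (∑-distrib-+ (λ i → 2 * a i) b) (cong₂ _+_ (Σ[<]-*ˡ t 2 a) (sym (Σ[<]≡∑ t b)))

∃-or-∑-≤ : ∀ {n} {P : Fin n → Set} {f g : Fin n → ℕ} →
           (∀ i → P i ⊎ f i ≤ g i) → Σ (Fin n) P ⊎ sum f ≤ sum g
∃-or-∑-≤ {zero}  _ = inj₂ z≤n
∃-or-∑-≤ {suc n} P⊎≤ with P⊎≤ zero | ∃-or-∑-≤ (P⊎≤ ∘ suc)
... | inj₁ p  | _             = inj₁ (zero , p)
... | inj₂ _  | inj₁ (i , p)  = inj₁ (suc i , p)
... | inj₂ f≤ | inj₂ ∑f≤      = inj₂ (+-mono-≤ f≤ ∑f≤)

toℕ-step : ∀ {m} (s : Fin (suc m)) k → toℕ (step s k) ≡ (toℕ s + k) % suc m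
toℕ-step {m} s k = toℕ-fromℕ< (m%n<n (toℕ s + k) (suc m))

step-0 : ∀ {m} (s : Fin (suc m)) → step s 0 ≡ s
step-0 {m} s = toℕ-injective (begin
  toℕ (step s 0)       ≡⟨ toℕ-step s 0 ⟩
  (toℕ s + 0) % suc m  ≡⟨ cong (_% suc m) (+-identityʳ (toℕ s)) ⟩
  toℕ s % suc m        ≡⟨ m<n⇒m%n≡m (toℕ<n s) ⟩
  toℕ s                ∎)

step-step : ∀ {m} (s : Fin (suc m)) j k → step (step s j) k ≡ step s (j + k)
step-step {m} s j k = toℕ-injective (begin
  toℕ (step (step s j) k)               ≡⟨ toℕ-step (step s j) k ⟩
  (toℕ (step s j) + k) % N              ≡⟨ cong (λ x → (x + k) % N) (toℕ-step s j) ⟩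
  ((toℕ s + j) % N + k) % N             ≡⟨ %-distribˡ-+ ((toℕ s + j) % N) k N ⟩
  ((toℕ s + j) % N % N + k % N) % N     ≡⟨ cong (λ x → (x + k % N) % N) (m%n%n≡m%n (toℕ s + j) N) ⟩
  ((toℕ s + j) % N + k % N) % N         ≡⟨ %-distribˡ-+ (toℕ s + j) k N ⟨
  (toℕ s + j + k) % N                   ≡⟨ cong (_% N) (+-assoc (toℕ s) j k) ⟩
  (toℕ s + (j + k)) % N                 ≡⟨ toℕ-step s (j + k) ⟨
  toℕ (step s (j + k))                  ∎)
  where N = suc m

step-inject₁-1 : ∀ {m} (j : Fin m) → step (inject₁ j) 1 ≡ suc j
step-inject₁-1 {m} j = toℕ-injective (begin
  toℕ (step (inject₁ j) 1)      ≡⟨ toℕ-step (inject₁ j) 1 ⟩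
  (toℕ (inject₁ j) + 1) % suc m ≡⟨ cong (λ x → (x + 1) % suc m) (toℕ-inject₁ j) ⟩
  (toℕ j + 1) % suc m           ≡⟨ cong (_% suc m) (+-comm (toℕ j) 1) ⟩
  suc (toℕ j) % suc m           ≡⟨ m<n⇒m%n≡m (s≤s (toℕ<n j)) ⟩
  suc (toℕ j)                   ∎)

step-fromℕ-1 : ∀ m → step (fromℕ m) 1 ≡ zero
step-fromℕ-1 m = toℕ-injective (begin
  toℕ (step (fromℕ m) 1)      ≡⟨ toℕ-step (fromℕ m) 1 ⟩
  (toℕ (fromℕ m) + 1) % suc m ≡⟨ cong (λ x → (x + 1) % suc m) (toℕ-fromℕ m) ⟩
  (m + 1) % suc m             ≡⟨ cong (_% suc m) (+-comm m 1) ⟩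
  suc m % suc m               ≡⟨ n%n≡0 (suc m) ⟩
  0                           ∎)

∑-∘-step-1 : ∀ {m} (f : Fin (suc m) → ℕ) → ∑[ s < suc m ] f (step s 1) ≡ sum f
∑-∘-step-1 {m} f = begin
  ∑[ s < suc m ] f (step s 1)                           ≡⟨ sum-init-last (λ s → f (step s 1)) ⟩
  ∑[ j < m ] f (step (inject₁ j) 1) + f (step (fromℕ m) 1)
    ≡⟨ cong₂ _+_ (sum-cong-≗ (cong f ∘ step-inject₁-1)) (cong f (step-fromℕ-1 m)) ⟩
  ∑[ j < m ] f (suc j) + f zero                         ≡⟨ +-comm _ (f zero) ⟩
  sum f                                                 ∎

∑-∘-step : ∀ {m} k (f : Fin (suc m) → ℕ) → ∑[ s < suc m ] f (step s k) ≡ sum f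
∑-∘-step zero    f = sum-cong-≗ (cong f ∘ step-0)
∑-∘-step (suc k) f = begin
  ∑[ s < _ ] f (step s (suc k))     ≡⟨ sum-cong-≗ (λ s → cong f (step-step s 1 k)) ⟨
  ∑[ s < _ ] f (step (step s 1) k)  ≡⟨ ∑-∘-step-1 (λ v → f (step v k)) ⟩
  ∑[ v < _ ] f (step v k)           ≡⟨ ∑-∘-step k f ⟩
  sum f                             ∎

step-≢ : ∀ {m} (v : Fin (suc m)) {d} → 0 < d → d < suc m → step v d ≢ v
step-≢ {m} v {d} 0<d d<N step≡v with toℕ v + d <? suc m
... | yes x+d<N = >⇒≢ (m<m+n x 0<d) (begin
  x + d           ≡⟨ m<n⇒m%n≡m x+d<N ⟨
  (x + d) % N     ≡⟨ toℕ-step v d ⟨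
  toℕ (step v d)  ≡⟨ cong toℕ step≡v ⟩
  x               ∎)
  where x = toℕ v; N = suc m
... | no x+d≮N = <⇒≢ x+d∸N<x (begin
  x + d ∸ N       ≡⟨ m<n⇒m%n≡m (<-trans x+d∸N<x (toℕ<n v)) ⟨
  (x + d ∸ N) % N ≡⟨ m≤n⇒[n∸m]%m≡n%m N≤x+d ⟩
  (x + d) % N     ≡⟨ toℕ-step v d ⟨
  toℕ (step v d)  ≡⟨ cong toℕ step≡v ⟩
  x               ∎)
  where
  x = toℕ v
  N = suc m
  N≤x+d : N ≤ x + d
  N≤x+d = ≮⇒≥ x+d≮N
  x+d∸N<x : x + d ∸ N < x
  x+d∸N<x = subst (x + d ∸ N <_) (m+n∸n≡m x N) (∸-monoˡ-< (+-monoʳ-< x d<N) N≤x+d)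

step-∉-onPath : ∀ {m} (s : Fin (suc m)) {q} → q < suc m → ¬ onPath s q (step s q)
step-∉-onPath s {q} q<N (k , k<q , stepₖ≡stepq) =
  step-≢ (step s k) (m<n⇒0<n∸m k<q) (≤-<-trans (m∸n≤m q k) q<N) (begin
    step (step s k) (q ∸ k) ≡⟨ step-step s k (q ∸ k) ⟩
    step s (k + (q ∸ k))    ≡⟨ cong (step s) (m+[n∸m]≡n (<⇒≤ k<q)) ⟩
    step s q                ≡⟨ stepₖ≡stepq ⟨
    step s k                ∎)

𝟙 : Bool → ℕ
𝟙 b = if b then 1 else 0

𝟙≤1 : ∀ b → 𝟙 b ≤ 1
𝟙≤1 true  = ≤-refl
𝟙≤1 false = z≤n

all-true-or-𝟙-sum≤2 : ∀ a b c → (a ≡ true × b ≡ true × c ≡ true) ⊎ 𝟙 a + 𝟙 b + 𝟙 c ≤ 2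
all-true-or-𝟙-sum≤2 true  true  true  = inj₁ (refl , refl , refl)
all-true-or-𝟙-sum≤2 true  true  false = inj₂ ≤-refl
all-true-or-𝟙-sum≤2 true  false c     = inj₂ (s≤s (𝟙≤1 c))
all-true-or-𝟙-sum≤2 false b     c     = inj₂ (+-mono-≤ (𝟙≤1 b) (𝟙≤1 c))

∣∣≡∑𝟙 : ∀ {n} (X : Subset n) → ∣ X ∣ ≡ ∑[ i < n ] 𝟙 (lookup X i)
∣∣≡∑𝟙 []          = refl
∣∣≡∑𝟙 (true ∷ X)  = cong suc (∣∣≡∑𝟙 X)
∣∣≡∑𝟙 (false ∷ X) = ∣∣≡∑𝟙 X

PathWitness : ∀ {n} → ℕ → Subset n → Subset n → Set
PathWitness {n} q S T = Σ (Fin n) λ s →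
  s ∈ S × step s (q ∸ 1) ∈ S × (∃ λ v → v ∈ T × ¬ onPath s q v)

module _ {m} (S T : Subset (suc m)) (j k : ℕ) where

  private
    𝟙S 𝟙T : Fin (suc m) → ℕ
    𝟙S = 𝟙 ∘ lookup S
    𝟙T = 𝟙 ∘ lookup T

  hits : Fin (suc m) → ℕ
  hits s = 𝟙S s + 𝟙S (step s j) + 𝟙T (step s k)

  all-hit-or-hits≤2 : ∀ s → (s ∈ S × step s j ∈ S × step s k ∈ T) ⊎ hits s ≤ 2
  all-hit-or-hits≤2 s with all-true-or-𝟙-sum≤2 (lookup S s) (lookup S (step s j)) (lookup T (step s k))
  ... | inj₁ (a , b , c) = inj₁ (lookup⇒[]= _ S a , lookup⇒[]= _ S b , lookup⇒[]= _ T c)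
  ... | inj₂ hits≤2      = inj₂ hits≤2

  ∑hits≡2∣S∣+∣T∣ : sum hits ≡ 2 * ∣ S ∣ + ∣ T ∣
  ∑hits≡2∣S∣+∣T∣ = begin
    ∑[ s < _ ] (𝟙S s + 𝟙S (step s j) + 𝟙T (step s k))
      ≡⟨ ∑-distrib-+ (λ s → 𝟙S s + 𝟙S (step s j)) (λ s → 𝟙T (step s k)) ⟩
    ∑[ s < _ ] (𝟙S s + 𝟙S (step s j)) + ∑[ s < _ ] 𝟙T (step s k)
      ≡⟨ cong₂ _+_ (∑-distrib-+ 𝟙S (λ s → 𝟙S (step s j))) (∑-∘-step k 𝟙T) ⟩
    sum 𝟙S + ∑[ s < _ ] 𝟙S (step s j) + sum 𝟙T
      ≡⟨ cong (λ x → sum 𝟙S + x + sum 𝟙T) (∑-∘-step j 𝟙S) ⟩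
    sum 𝟙S + sum 𝟙S + sum 𝟙T
      ≡⟨ cong₂ (λ x y → x + x + y) (∣∣≡∑𝟙 S) (∣∣≡∑𝟙 T) ⟨
    ∣ S ∣ + ∣ S ∣ + ∣ T ∣
      ≡⟨ cong (λ x → ∣ S ∣ + x + ∣ T ∣) (+-identityʳ ∣ S ∣) ⟨
    2 * ∣ S ∣ + ∣ T ∣ ∎

path-witness-or-2∣S∣+∣T∣≤2n : ∀ {n q} → q < n → (S T : Subset n) →
                               PathWitness q S T ⊎ 2 * ∣ S ∣ + ∣ T ∣ ≤ 2 * n
path-witness-or-2∣S∣+∣T∣≤2n {suc m} {q} q<n S T with ∃-or-∑-≤ (all-hit-or-hits≤2 S T (q ∸ 1) q)
... | inj₁ (s , s∈S , end∈S , next∈T) =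
  inj₁ (s , s∈S , end∈S , step s q , next∈T , step-∉-onPath s q<n)
... | inj₂ ∑hits≤∑2 =
  inj₂ (subst₂ _≤_ (∑hits≡2∣S∣+∣T∣ S T (q ∸ 1) q) (∑-const (suc m) 2) ∑hits≤∑2)

2N<3a⇒2N<3b⇒2N<2a+b : ∀ N a b → 2 * N < 3 * a → 2 * N < 3 * b → 2 * N < 2 * a + b
2N<3a⇒2N<3b⇒2N<2a+b N a b 2N<3a 2N<3b = *-cancelˡ-< 3 (2 * N) (2 * a + b)
  (subst₂ _<_ (six-N N) (regroup a b) (+-mono-< (*-monoʳ-< 2 2N<3a) 2N<3b))
  where
  six-N : ∀ N → 2 * (2 * N) + 2 * N ≡ 3 * (2 * N)
  six-N = solve-∀
  regroup : ∀ a b → 2 * (3 * a) + 3 * b ≡ 3 * (2 * a + b)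
  regroup = solve-∀

≤∸1⇒< : ∀ {m n} → 1 ≤ n → m ≤ n ∸ 1 → m < n
≤∸1⇒< {n = suc _} _ m≤n∸1 = s≤s m≤n∸1

lemma1 : (t : ℕ) (n : Fin t → ℕ) → (∀ i → 3 ≤ n i) →
         (q : Fin t → ℕ) → (∀ i → 1 ≤ q i × q i ≤ n i ∸ 1) →
         (S T : VSubset t n) →
         2 * totalVerts t n < 3 * card S →
         2 * totalVerts t n < 3 * card T →
         Σ (Fin t) λ i → Σ (Fin (n i)) λ s →
           s ∈ S i × step s (q i ∸ 1) ∈ S i ×
           (∃ λ v → v ∈ T i × ¬ onPath s (q i) v)
lemma1 t n 3≤n q q-bounds S T 2N<3∣S∣ 2N<3∣T∣
  with ∃-or-∑-≤ (λ i → path-witness-or-2∣S∣+∣T∣≤2n (q<n i) (S i) (T i))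
  where
  q<n : ∀ i → q i < n i
  q<n i = ≤∸1⇒< (≤-trans (s≤s z≤n) (3≤n i)) (proj₂ (q-bounds i))
... | inj₁ witness = witness
... | inj₂ ∑≤∑ = ⊥-elim (≤⇒≯ 2∣S∣+∣T∣≤2N 2N<2∣S∣+∣T∣)
  where
  2∣S∣+∣T∣≤2N : 2 * card S + card T ≤ 2 * totalVerts t n
  2∣S∣+∣T∣≤2N = subst₂ _≤_ (Σ[<]-2a+b t (∣_∣ ∘ S) (∣_∣ ∘ T)) (Σ[<]-*ˡ t 2 n) ∑≤∑
  2N<2∣S∣+∣T∣ : 2 * totalVerts t n < 2 * card S + card T
  2N<2∣S∣+∣T∣ = 2N<3a⇒2N<3b⇒2N<2a+b (totalVerts t n) (card S) (card T) 2N<3∣S∣ 2N<3∣T∣
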